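{- For all integers $n\ge0$ and $t\ge1$ there is a $\mathcal{C}^t_2$-sentence $\phi$ of size $O(n/t)$ such that for every $m>n$, $\mathcal{A}_n\models\phi$ and $\mathcal{A}_m\models\neg\phi$.
   Context: $\mathcal{A}_n$ is the linear order on $\{0,\dots,n\}$ with the standard order $<$ (signature $\{min,max,<,succ\}$). Counting logic extends first-order logic by $\exists^{\ge k}x\,\varphi$ (at least $k$ distinct values of $x$ satisfy $\varphi$) and $\forall^{\ge k}x\,\varphi:=\neg\exists^{\ge k}x\,\neg\varphi$; $\mathcal{C}^t_2$ is the fragment with at most 2 variables and all counting quantifiers having $k\le t$. Size: atomic $=1$, $|\neg\varphi|=|\varphi|+1$, $|\varphi\vee\psi|=|\varphi\wedge\psi|=|\varphi|+|\psi|$, $|Q^{\ge k}x\,\varphi|=|\varphi|+1$. -}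

module Defs where

open import Data.Nat using (ℕ; zero; suc; _+_; _<_; _≤_)
open import Data.Bool using (Bool; true; false; _∨_; if_then_else_)
open import Data.Fin using (Fin; toℕ)
open import Data.Product using (Σ; _×_)
open import Data.Sum using (_⊎_)
open import Data.Empty using (⊥)
open import Relation.Nullary using (¬_)
open import Relation.Binary.PropositionalEquality using (_≡_)
open import Function.Definitions using (Injective)

Var : Set
Var = Bool

x y : Var
x = true
y = false

data Term : Set where
  var  : Var → Term
  minc : Term
  maxc : Term

data Form : Set where
  eq   : Term → Term → Form
  lt   : Term → Term → Form
  sc   : Term → Term → Form          -- succ(t₁, t₂) : t₂ = t₁ + 1
  neg  : Form → Form
  or   : Form → Form → Form
  and  : Form → Form → Form
  exC  : ℕ → Var → Form → Form
  allC : ℕ → Var → Form → Form      -- ∀^{≥k} v φ := ¬ ∃^{≥k} v ¬φ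

size : Form → ℕ
size (eq _ _)     = 1
size (lt _ _)     = 1
size (sc _ _)     = 1
size (neg φ)      = suc (size φ)
size (or φ ψ)     = size φ + size ψ
size (and φ ψ)    = size φ + size ψ
size (exC _ _ φ)  = suc (size φ)
size (allC _ _ φ) = suc (size φ)

InC : ℕ → Form → Set
InC t (eq _ _)     = Data.Unit.⊤ where import Data.Unit
InC t (lt _ _)     = Data.Unit.⊤ where import Data.Unit
InC t (sc _ _)     = Data.Unit.⊤ where import Data.Unit
InC t (neg φ)      = InC t φ
InC t (or φ ψ)     = InC t φ × InC t ψ
InC t (and φ ψ)    = InC t φ × InC t ψ
InC t (exC k _ φ)  = (1 ≤ k × k ≤ t) × InC t φ
InC t (allC k _ φ) = (1 ≤ k × k ≤ t) × InC t φ

sameVar : Var → Var → Bool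
sameVar true  true  = true
sameVar false false = true
sameVar _     _     = false

freeT : Var → Term → Bool
freeT v (var w) = sameVar v w
freeT v minc    = false
freeT v maxc    = false

free : Var → Form → Bool
free v (eq s u)     = freeT v s ∨ freeT v u
free v (lt s u)     = freeT v s ∨ freeT v u
free v (sc s u)     = freeT v s ∨ freeT v u
free v (neg φ)      = free v φ
free v (or φ ψ)     = free v φ ∨ free v ψ
free v (and φ ψ)    = free v φ ∨ free v ψ
free v (exC _ w φ)  = if sameVar v w then false else free v φ
free v (allC _ w φ) = if sameVar v w then false else free v φ

Sentence : Form → Set
Sentence φ = (free x φ ≡ false) × (free y φ ≡ false)

-- Semantics in 𝒜ₙ, the linear order on {0,…,n} (= Fin (suc n)).
Assign : ℕ → Set
Assign n = Var → Fin (suc n)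

update : ∀ {n} → Assign n → Var → Fin (suc n) → Assign n
update ρ v a w = if sameVar v w then a else ρ w

evalT : ∀ {n} → Assign n → Term → Fin (suc n)
evalT ρ (var v) = ρ v
evalT ρ minc    = Data.Fin.zero where import Data.Fin
evalT {n} ρ maxc = Data.Fin.fromℕ n where import Data.Fin

Sat : (n : ℕ) → Form → Assign n → Set
Sat n (eq s u)     ρ = evalT ρ s ≡ evalT ρ u
Sat n (lt s u)     ρ = toℕ (evalT ρ s) < toℕ (evalT ρ u)
Sat n (sc s u)     ρ = toℕ (evalT ρ u) ≡ suc (toℕ (evalT ρ s))
Sat n (neg φ)      ρ = ¬ Sat n φ ρ
Sat n (or φ ψ)     ρ = Sat n φ ρ ⊎ Sat n ψ ρ
Sat n (and φ ψ)    ρ = Sat n φ ρ × Sat n ψ ρ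
-- at least k distinct values a of v satisfy φ
Sat n (exC k v φ)  ρ =
  Σ (Fin k → Fin (suc n)) λ f → Injective _≡_ _≡_ f × (∀ i → Sat n φ (update ρ v (f i)))
Sat n (allC k v φ) ρ =
  ¬ (Σ (Fin k → Fin (suc n)) λ f → Injective _≡_ _≡_ f × (∀ i → ¬ Sat n φ (update ρ v (f i))))

_⊨_ : ℕ → Form → Set
n ⊨ φ = ∀ (ρ : Assign n) → Sat n φ ρ

{-# OPTIONS --safe #-}
-- If ψ(w) defines w ≥ c, then ∃^{≥t} w (w < v ∧ ψ(w)) defines v ≥ c + t: counting
-- quantifiers of rank t raise a lower bound by t at constant cost, so alternating the
-- two variables defines v ≥ q·t by a formula of size O(q).  Writing n = q·t + r with
-- r < t, the sentence ¬ ∃^{≥r+1} y ∃x (x < y ∧ x ≥ q·t) then says that max ≤ n.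
module Submission where

open import Defs
open import Data.Nat using (ℕ; NonZero; zero; suc; _+_; _*_; _∸_; _/_; _%_; _<_; _≤_; z≤n; s≤s; s≤s⁻¹; >-nonZero⁻¹)
open import Data.Nat.Properties
open import Data.Nat.DivMod using (m≡m%n+[m/n]*n; m%n<n)
open import Data.Fin as Fin using (Fin; toℕ; fromℕ<; inject≤; _↑ʳ_)
open import Data.Fin.Properties
  using (toℕ-injective; toℕ<n; toℕ-fromℕ<; toℕ-inject≤; toℕ-↑ʳ; inject≤-injective; ↑ʳ-injective; injective⇒≤)
open import Data.Product using (Σ; _×_; _,_; proj₁; proj₂)
open import Data.Bool using (true; false; not)
open import Data.Unit using (tt)
open import Function.Bundles using (_⇔_; mk⇔; Equivalence)
open import Function.Definitions using (Injective)
open import Relation.Binary.PropositionalEquality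

open Equivalence using (to; from)

AtLeast : ∀ {m} → ℕ → (Fin (suc m) → Set) → Set
AtLeast {m} k P = Σ (Fin k → Fin (suc m)) λ f → Injective _≡_ _≡_ f × (∀ i → P (f i))

atLeast-map : ∀ {m k} {P Q : Fin (suc m) → Set} → (∀ a → P a → Q a) → AtLeast k P → AtLeast k Q
atLeast-map h (f , f-inj , Pf) = f , f-inj , λ i → h (f i) (Pf i)

Between : ∀ {m} → ℕ → ℕ → Fin (suc m) → Set
Between lo hi a = lo ≤ toℕ a × toℕ a < hi

atLeast-between⇒ : ∀ {m} k .{{_ : NonZero k}} {lo hi} → AtLeast {m} k (Between lo hi) → k + lo ≤ hi
atLeast-between⇒ (suc k) {lo} {hi} (f , f-inj , inside) =
  m≤o∸n⇒m+n≤o (suc k) lo≤hi (injective⇒≤ {f = shift} shift-inj)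
  where
  lo≤hi : lo ≤ hi
  lo≤hi = ≤-trans (proj₁ (inside Fin.zero)) (<⇒≤ (proj₂ (inside Fin.zero)))
  shifted< : ∀ i → toℕ (f i) ∸ lo < hi ∸ lo
  shifted< i = ∸-monoˡ-< (proj₂ (inside i)) (proj₁ (inside i))
  shift : Fin (suc k) → Fin (hi ∸ lo)
  shift i = fromℕ< (shifted< i)
  shift-inj : Injective _≡_ _≡_ shift
  shift-inj {i} {j} si≡sj = f-inj (toℕ-injective (∸-cancelʳ-≡ (proj₁ (inside i)) (proj₁ (inside j))
    (trans (sym (toℕ-fromℕ< (shifted< i))) (trans (cong toℕ si≡sj) (toℕ-fromℕ< (shifted< j))))))

atLeast-between⇐ : ∀ {m} k {lo hi} → hi ≤ suc m → k + lo ≤ hi → AtLeast {m} k (Between lo hi)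
atLeast-between⇐ {m} k {lo} {hi} hi≤ k+lo≤hi = f , f-inj , inside
  where
  lo+k≤ : lo + k ≤ suc m
  lo+k≤ = ≤-trans (≤-reflexive (+-comm lo k)) (≤-trans k+lo≤hi hi≤)
  f : Fin k → Fin (suc m)
  f i = inject≤ (lo ↑ʳ i) lo+k≤
  toℕ-f : ∀ i → toℕ (f i) ≡ lo + toℕ i
  toℕ-f i = trans (toℕ-inject≤ (lo ↑ʳ i) lo+k≤) (toℕ-↑ʳ lo i)
  f-inj : Injective _≡_ _≡_ f
  f-inj {i} {j} fi≡fj = ↑ʳ-injective lo i j (inject≤-injective lo+k≤ lo+k≤ _ _ fi≡fj)
  inside : ∀ i → Between lo hi (f i)
  inside i rewrite toℕ-f i =
    m≤m+n lo (toℕ i) , <-≤-trans (+-monoʳ-< lo (toℕ<n i)) (≤-trans (≤-reflexive (+-comm lo k)) k+lo≤hi)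

atLeast-below : ∀ {m} k .{{_ : NonZero k}} {P : Fin (suc m) → Set} {c b} →
  (∀ a → P a ⇔ c ≤ toℕ a) → b ≤ suc m → AtLeast k (λ a → toℕ a < b × P a) ⇔ k + c ≤ b
atLeast-below k {P} {c} {b} P⇔ b≤ = mk⇔
  (λ many → atLeast-between⇒ k (atLeast-map into many))
  (λ k+c≤b → atLeast-map outOf (atLeast-between⇐ k b≤ k+c≤b))
  where
  into : ∀ a → toℕ a < b × P a → Between c b a
  into a (a<b , Pa) = to (P⇔ a) Pa , a<b
  outOf : ∀ a → Between c b a → toℕ a < b × P a
  outOf a (c≤a , a<b) = a<b , from (P⇔ a) c≤a

atLeast-above : ∀ {m} k .{{_ : NonZero k}} {P : Fin (suc m) → Set} {c} →
  (∀ a → P a ⇔ c ≤ toℕ a) → AtLeast k P ⇔ k + c ≤ suc m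
atLeast-above {m} k {P} {c} P⇔ = mk⇔
  (λ many → atLeast-between⇒ k (atLeast-map into many))
  (λ k+c≤ → atLeast-map outOf (atLeast-between⇐ k ≤-refl k+c≤))
  where
  into : ∀ a → P a → Between c (suc m) a
  into a Pa = to (P⇔ a) Pa , toℕ<n a
  outOf : ∀ a → Between c (suc m) a → P a
  outOf a (c≤a , _) = from (P⇔ a) c≤a

geq : ℕ → ℕ → Var → Form
geq t zero    v = eq (var v) (var v)
geq t (suc j) v = exC t (not v) (and (lt (var (not v)) (var v)) (geq t j (not v)))

sat-geq : ∀ {m} t .{{_ : NonZero t}} j v (ρ : Assign m) → Sat m (geq t j v) ρ ⇔ j * t ≤ toℕ (ρ v)
sat-geq t zero    v     ρ = mk⇔ (λ _ → z≤n) (λ _ → refl)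
sat-geq t (suc j) true  ρ = atLeast-below t (λ a → sat-geq t j false (update ρ false a)) (<⇒≤ (toℕ<n (ρ true)))
sat-geq t (suc j) false ρ = atLeast-below t (λ a → sat-geq t j true (update ρ true a)) (<⇒≤ (toℕ<n (ρ false)))

size-geq : ∀ t j v → size (geq t j v) ≡ suc (2 * j)
size-geq t zero    v = refl
size-geq t (suc j) v = trans (cong (2 +_) (size-geq t j (not v))) (cong suc (sym (*-suc 2 j)))

inC-geq : ∀ t j v → 1 ≤ t → InC t (geq t j v)
inC-geq t zero    v 1≤t = tt
inC-geq t (suc j) v 1≤t = (1≤t , ≤-refl) , tt , inC-geq t j (not v) 1≤t

gt : ℕ → ℕ → Form
gt t q = exC 1 x (and (lt (var x) (var y)) (geq t q x))

sat-gt : ∀ {m} t .{{_ : NonZero t}} q (ρ : Assign m) → Sat m (gt t q) ρ ⇔ q * t < toℕ (ρ y)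
sat-gt t q ρ = atLeast-below 1 (λ a → sat-geq t q x (update ρ x a)) (<⇒≤ (toℕ<n (ρ y)))

maxAtMost : ℕ → ℕ → ℕ → Form
maxAtMost t q r = neg (exC (suc r) y (gt t q))

sat-maxAtMost : ∀ {m} t .{{_ : NonZero t}} q r (ρ : Assign m) → Sat m (maxAtMost t q r) ρ ⇔ m ≤ r + q * t
sat-maxAtMost {m} t q r ρ = mk⇔
  (λ ¬many → ≮⇒≥ (λ n<m → ¬many (from manyAbove (s≤s (subst (_≤ m) (sym (+-suc r (q * t))) n<m)))))
  (λ m≤n many → ≤⇒≯ m≤n (subst (_≤ m) (+-suc r (q * t)) (s≤s⁻¹ (to manyAbove many))))
  where
  manyAbove : Sat m (exC (suc r) y (gt t q)) ρ ⇔ suc r + suc (q * t) ≤ suc m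
  manyAbove = atLeast-above (suc r) (λ b → sat-gt t q (update ρ y b))

size-maxAtMost : ∀ t q r → size (maxAtMost t q r) ≤ 5 * q + 5
size-maxAtMost t q r = begin
  size (maxAtMost t q r) ≡⟨ cong (4 +_) (size-geq t q x) ⟩
  5 + 2 * q             ≡⟨ +-comm 5 (2 * q) ⟩
  2 * q + 5             ≤⟨ +-monoˡ-≤ 5 (*-monoˡ-≤ q (m≤m+n 2 3)) ⟩
  5 * q + 5             ∎
  where open ≤-Reasoning

inC-maxAtMost : ∀ t q r → 1 ≤ t → r < t → InC t (maxAtMost t q r)
inC-maxAtMost t q r 1≤t r<t = (s≤s z≤n , r<t) , (s≤s z≤n , 1≤t) , tt , inC-geq t q x 1≤t

proposition1 : Σ ℕ λ C → ∀ (n t : ℕ) .{{_ : NonZero t}} →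
    Σ Form λ φ → InC t φ × Sentence φ × size φ ≤ C * (n / t) + C ×
    (n ⊨ φ) × (∀ (m : ℕ) → n < m → m ⊨ neg φ)
proposition1 = 5 , λ n t →
  let q = n / t
      r = n % t
      n≡r+qt = m≡m%n+[m/n]*n n t
  in maxAtMost t q r
   , inC-maxAtMost t q r (>-nonZero⁻¹ t) (m%n<n n t)
   , (refl , refl)
   , size-maxAtMost t q r
   , (λ ρ → from (sat-maxAtMost t q r ρ) (≤-reflexive n≡r+qt))
   , (λ m n<m ρ sat → <⇒≱ n<m (subst (m ≤_) (sym n≡r+qt) (to (sat-maxAtMost t q r ρ) sat)))
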